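{- Let $6 \leq b \leq c$ be integers. Then $\left|\mathcal{F}(K_{1,b,c})\right| = 1 + b$.
   Context: All graphs are finite, undirected and simple, and are considered up to isomorphism. $K_{1,b,c}$ is the complete tripartite graph with parts of sizes $1,b,c$. A Triangle-Y ($\nabla Y$) move on a graph takes a 3-cycle with vertices $x,y,z$, deletes the edges $xy,yz,zx$, and adds a new vertex $v$ with edges $xv,yv,zv$. A Y-Triangle ($Y\nabla$) move is the inverse operation: for a vertex $v$ of degree three whose neighbours $x,y,z$ are pairwise non-adjacent, delete $v$ and add the edges $xy,yz,zx$. Two graphs are cousins if one is obtained from the other by a sequence of zero or more $\nabla Y$ and $Y\nabla$ moves. The family $\mathcal{F}(G)$ is the set of (isomorphism classes of) cousins of $G$, and $|\mathcal{F}(G)|$ is its size. -}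

module Defs where

open import Data.Nat using (ℕ; zero; suc; _+_; _≤ᵇ_; _≡ᵇ_)
open import Data.Nat.Properties using (≡ᵇ⇒≡; ≡⇒≡ᵇ)
open import Data.Fin using (Fin; toℕ; punchIn) renaming (_≟_ to _≟F_)
open import Data.Bool using (Bool; true; false; not; _∧_; _∨_; if_then_else_)
open import Data.Product using (Σ; ∃; _×_; _,_)
open import Relation.Nullary using (¬_)
open import Relation.Nullary.Decidable using (⌊_⌋)
open import Relation.Binary.PropositionalEquality using (_≡_; _≢_; refl; sym)
open import Relation.Binary.Construct.Closure.ReflexiveTransitive using (Star)
open import Function.Bundles using (_⤖_; Bijection)

record GraphOn (n : ℕ) : Set where
  field
    adj    : Fin n → Fin n → Bool
    adj-sym : ∀ i j → adj i j ≡ adj j i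
    irrefl : ∀ i → adj i i ≡ false
open GraphOn public

Graph : Set
Graph = Σ ℕ GraphOn

_≅_ : Graph → Graph → Set
(n , G) ≅ (m , H) =
  Σ (Fin n ⤖ Fin m) λ f →
    ∀ i j → adj H (Bijection.to f i) (Bijection.to f j) ≡ adj G i j

inT : ∀ {n} → Fin n → Fin n → Fin n → Fin n → Bool
inT x y z i = ⌊ i ≟F x ⌋ ∨ ⌊ i ≟F y ⌋ ∨ ⌊ i ≟F z ⌋

-- Triangle-Y move: G has a 3-cycle x,y,z; H arises by deleting its edges
-- and adding a new vertex v (placed at position v; old vertices are
-- relabelled by punchIn v) adjacent exactly to x, y, z.
ΔY : ∀ {n} → GraphOn n → GraphOn (suc n) → Set
ΔY {n} G H =
  Σ (Fin (suc n)) λ v → Σ (Fin n) λ x → Σ (Fin n) λ y → Σ (Fin n) λ z →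
    (x ≢ y × y ≢ z × x ≢ z)
    × (adj G x y ≡ true × adj G y z ≡ true × adj G x z ≡ true)
    × (∀ i → adj H v (punchIn v i) ≡ inT x y z i)
    × (∀ i j → adj H (punchIn v i) (punchIn v j)
                 ≡ (adj G i j ∧ not (inT x y z i ∧ inT x y z j)))

-- Y-Triangle move: v in G has degree three, with pairwise non-adjacent
-- neighbours x,y,z (neighbours written as punchIn v x etc.); H arises by
-- deleting v and adding the edges xy, yz, zx.
YΔ : ∀ {n} → GraphOn (suc n) → GraphOn n → Set
YΔ {n} G H =
  Σ (Fin (suc n)) λ v → Σ (Fin n) λ x → Σ (Fin n) λ y → Σ (Fin n) λ z →
    (x ≢ y × y ≢ z × x ≢ z)
    × (∀ i → adj G v (punchIn v i) ≡ inT x y z i)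
    × (adj G (punchIn v x) (punchIn v y) ≡ false
       × adj G (punchIn v y) (punchIn v z) ≡ false
       × adj G (punchIn v x) (punchIn v z) ≡ false)
    × (∀ i j → adj H i j
                 ≡ (adj G (punchIn v i) (punchIn v j)
                    ∨ (inT x y z i ∧ inT x y z j ∧ not ⌊ i ≟F j ⌋)))

data Move : Graph → Graph → Set where
  dy : ∀ {n} {G : GraphOn n} {H : GraphOn (suc n)} → ΔY G H → Move (n , G) (suc n , H)
  yd : ∀ {n} {G : GraphOn (suc n)} {H : GraphOn n} → YΔ G H → Move (suc n , G) (n , H)

Cousin : Graph → Graph → Set
Cousin = Star Move

-- Complete tripartite graph K_{1,b,c}: vertex 0 is the part of size 1,
-- vertices 1..b the part of size b, vertices b+1..b+c the part of size c.
part : ℕ → ℕ → ℕ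
part b zero = 0
part b (suc i) = if suc i ≤ᵇ b then 1 else 2

private
  ≡ᵇ-refl : ∀ m → (m ≡ᵇ m) ≡ true
  ≡ᵇ-refl zero = refl
  ≡ᵇ-refl (suc m) = ≡ᵇ-refl m

  ≡ᵇ-sym : ∀ m k → (m ≡ᵇ k) ≡ (k ≡ᵇ m)
  ≡ᵇ-sym zero zero = refl
  ≡ᵇ-sym zero (suc k) = refl
  ≡ᵇ-sym (suc m) zero = refl
  ≡ᵇ-sym (suc m) (suc k) = ≡ᵇ-sym m k

K1bcOn : (b c : ℕ) → GraphOn (suc (b + c))
K1bcOn b c = record
  { adj = λ i j → not (part b (toℕ i) ≡ᵇ part b (toℕ j))
  ; adj-sym = λ i j → congNot (≡ᵇ-sym (part b (toℕ i)) (part b (toℕ j)))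
  ; irrefl = λ i → congNot (≡ᵇ-refl (part b (toℕ i)))
  }
  where
  congNot : ∀ {p q : Bool} → p ≡ q → not p ≡ not q
  congNot refl = refl

K1bc : ℕ → ℕ → Graph
K1bc b c = suc (b + c) , K1bcOn b c

module Submission where

-- For k ≤ b let G_k be K_{1,b,c} in which the k disjoint triangles apex, b_t, c_t (t < k) have
-- been replaced by Y's. Every triangle of G_k is apex, b_i, c_j with i, j ≥ k, so up to an
-- automorphism of G_k a ΔY move turns G_k into G_{k+1}. As b, c ≥ 5, the apex and the vertices
-- of B and C have at least four neighbours, so a YΔ move can only undo one of the Y's, and up to
-- automorphism it turns G_k into G_{k-1}. Hence the cousins of K_{1,b,c} = G_0 are G_0, …, G_b,
-- which are pairwise non-isomorphic since G_k has 1 + b + c + k vertices.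

open import Defs
open import Data.Nat using (ℕ; zero; suc; _≤_; _<_; _+_; _≡ᵇ_; _<ᵇ_; z≤n; s≤s; _<?_)
open import Data.Nat.Properties
  using (≡ᵇ⇒≡; ≡⇒≡ᵇ; <ᵇ⇒<; <⇒<ᵇ; ≮⇒≥; ≤⇒≯; <⇒≢; <⇒≤; ≤-refl; ≤-reflexive; ≤-trans; <-≤-trans; ≤-<-trans;
         suc-injective; n≤1+n; ≤-pred; m≤m+n; +-cancelʳ-≡)
import Data.Fin as Fin
open import Data.Fin using (Fin; toℕ; fromℕ; fromℕ<; inject₁; inject≤; lower₁; punchIn; punchOut;
                            splitAt; join; _↑ˡ_; _↑ʳ_)
  renaming (zero to fzero; suc to fsuc; _≟_ to _≟F_)
open import Data.Fin.Properties
  using (toℕ-injective; toℕ<n; toℕ-fromℕ; toℕ-fromℕ<; toℕ-inject₁; toℕ-inject≤; fromℕ≢inject₁;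
         inject₁-lower₁; lower₁-inject₁′; punchInᵢ≢i; punchOut-cong; punchIn-punchOut;
         punchOut-punchIn; pigeonhole; splitAt-↑ˡ; splitAt-↑ʳ; join-splitAt; toℕ-↑ˡ; toℕ-↑ʳ)
open import Data.Fin.Permutation using (↔⇒≡)
open import Data.Bool using (Bool; true; false; not; _∧_; _∨_; if_then_else_)
open import Data.Bool.Properties
  using (T-≡; not-injective; ∧-comm; ∧-zeroʳ; ∧-identityʳ; ∧-idem; ∨-identityʳ; ∨-commutativeMonoid)
open import Data.Product using (Σ; ∃; ∃₂; _×_; _,_; proj₁; proj₂)
open import Data.Vec using ([]; _∷_; lookup)
open import Data.Sum using (_⊎_; inj₁; inj₂; [_,_])
open import Data.Empty using (⊥; ⊥-elim)
open import Relation.Nullary using (¬_; yes; no; Dec; contradiction)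
open import Relation.Nullary.Decidable using (⌊_⌋)
open import Relation.Binary.PropositionalEquality
  using (_≡_; _≢_; refl; sym; trans; cong; cong₂; subst; module ≡-Reasoning)
open import Relation.Binary.Construct.Closure.ReflexiveTransitive using (ε; _◅_; _◅◅_)
open import Function.Bundles using (_↔_; Inverse; mk↔ₛ′; Injection; Equivalence)
open import Function.Properties.Inverse using (↔⇒↣; ↔⇒⤖)
open import Function.Properties.Bijection using (⤖⇒↔)
open import Function.Construct.Composition using (_↔-∘_)
open import Function.Construct.Symmetry using (↔-sym)
open import Algebra.Bundles using (CommutativeMonoid)
open import Algebra.Properties.CommutativeSemigroup
  (CommutativeMonoid.commutativeSemigroup ∨-commutativeMonoid)
  using (x∙yz≈x∙zy; x∙yz≈y∙xz; x∙yz≈y∙zx; x∙yz≈z∙xy; x∙yz≈z∙yx)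
open import Function.Base using (_∘_)

open Inverse using (to; from; strictlyInverseˡ; strictlyInverseʳ)

true≢false : true ≢ false
true≢false ()

≡ᵇ-true⇒≡ : ∀ m n → (m ≡ᵇ n) ≡ true → m ≡ n
≡ᵇ-true⇒≡ m n e = ≡ᵇ⇒≡ m n (Equivalence.from T-≡ e)

≡⇒≡ᵇ-true : ∀ {m n} → m ≡ n → (m ≡ᵇ n) ≡ true
≡⇒≡ᵇ-true {m} {n} e = Equivalence.to T-≡ (≡⇒≡ᵇ m n e)

≡ᵇ-refl : ∀ m → (m ≡ᵇ m) ≡ true
≡ᵇ-refl m = ≡⇒≡ᵇ-true {m} refl

≢⇒≡ᵇ-false : ∀ m n → m ≢ n → (m ≡ᵇ n) ≡ false
≢⇒≡ᵇ-false m n m≢n with m ≡ᵇ n in e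
... | true = contradiction (≡ᵇ-true⇒≡ m n e) m≢n
... | false = refl

≡ᵇ-false⇒≢ : ∀ {m n} → (m ≡ᵇ n) ≡ false → m ≢ n
≡ᵇ-false⇒≢ {m} e refl = true≢false (trans (sym (≡ᵇ-refl m)) e)

≡ᵇ-cong-⇔ : ∀ {m n m′ n′} → (m ≡ n → m′ ≡ n′) → (m′ ≡ n′ → m ≡ n) → (m ≡ᵇ n) ≡ (m′ ≡ᵇ n′)
≡ᵇ-cong-⇔ {m} {n} {m′} {n′} f g with m ≡ᵇ n in e
... | true = sym (≡⇒≡ᵇ-true (f (≡ᵇ-true⇒≡ m n e)))
... | false = sym (≢⇒≡ᵇ-false m′ n′ (≡ᵇ-false⇒≢ e ∘ g))

≡ᵇ-sym : ∀ m n → (m ≡ᵇ n) ≡ (n ≡ᵇ m)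
≡ᵇ-sym m n = ≡ᵇ-cong-⇔ {m} {n} sym sym

<⇒<ᵇ-true : ∀ {m n} → m < n → (m <ᵇ n) ≡ true
<⇒<ᵇ-true m<n = Equivalence.to T-≡ (<⇒<ᵇ m<n)

≥⇒<ᵇ-false : ∀ m n → n ≤ m → (m <ᵇ n) ≡ false
≥⇒<ᵇ-false m n n≤m with m <ᵇ n in e
... | true = contradiction (<ᵇ⇒< m n (Equivalence.from T-≡ e)) (≤⇒≯ n≤m)
... | false = refl

<ᵇ-false⇒≥ : ∀ m n → (m <ᵇ n) ≡ false → n ≤ m
<ᵇ-false⇒≥ m n e = ≮⇒≥ (λ m<n → true≢false (trans (sym (<⇒<ᵇ-true m<n)) e))

<ᵇ-suc : ∀ m k → (m <ᵇ suc k) ≡ ((m <ᵇ k) ∨ (m ≡ᵇ k))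
<ᵇ-suc zero zero = refl
<ᵇ-suc zero (suc k) = refl
<ᵇ-suc (suc m) zero = refl
<ᵇ-suc (suc m) (suc k) = <ᵇ-suc m k

not-∨ : ∀ x y → not (x ∨ y) ≡ not x ∧ not y
not-∨ true y = refl
not-∨ false y = refl

swapℕ : ℕ → ℕ → ℕ → ℕ
swapℕ p q x = if x ≡ᵇ p then q else (if x ≡ᵇ q then p else x)

data SwapView (p q x : ℕ) : Set where
  at-p  : x ≡ p → swapℕ p q x ≡ q → SwapView p q x
  at-q  : x ≢ p → x ≡ q → swapℕ p q x ≡ p → SwapView p q x
  other : x ≢ p → x ≢ q → swapℕ p q x ≡ x → SwapView p q x

swapℕ-by : ∀ p q x {β₁ β₂} → (x ≡ᵇ p) ≡ β₁ → (x ≡ᵇ q) ≡ β₂ →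
           swapℕ p q x ≡ (if β₁ then q else (if β₂ then p else x))
swapℕ-by p q x refl refl = refl

swapView : ∀ p q x → SwapView p q x
swapView p q x with x ≡ᵇ p in e₁
... | true = at-p (≡ᵇ-true⇒≡ x p e₁) (swapℕ-by p q x e₁ refl)
... | false with x ≡ᵇ q in e₂
...   | true = at-q (≡ᵇ-false⇒≢ e₁) (≡ᵇ-true⇒≡ x q e₂) (swapℕ-by p q x e₁ e₂)
...   | false = other (≡ᵇ-false⇒≢ e₁) (≡ᵇ-false⇒≢ e₂) (swapℕ-by p q x e₁ e₂)

swapℕ-involutive : ∀ p q x → swapℕ p q (swapℕ p q x) ≡ x
swapℕ-involutive p q x with swapView p q x
... | at-p refl e rewrite e with swapView p q q
...   | at-p q≡p e′ = trans e′ q≡p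
...   | at-q _ _ e′ = e′
...   | other _ q≢q _ = contradiction refl q≢q
swapℕ-involutive p q x | at-q _ refl e rewrite e with swapView p q p
...   | at-p _ e′ = e′
...   | at-q p≢p _ _ = contradiction refl p≢p
...   | other p≢p _ _ = contradiction refl p≢p
swapℕ-involutive p q x | other _ _ e rewrite e = e

swapℕ-injective : ∀ p q {x y} → swapℕ p q x ≡ swapℕ p q y → x ≡ y
swapℕ-injective p q {x} {y} e =
  trans (sym (swapℕ-involutive p q x)) (trans (cong (swapℕ p q) e) (swapℕ-involutive p q y))

swapℕ-left : ∀ p q → swapℕ p q p ≡ q
swapℕ-left p q rewrite ≡ᵇ-refl p = refl

≡ᵇ-swapℕ : ∀ p q x y → (swapℕ p q x ≡ᵇ swapℕ p q y) ≡ (x ≡ᵇ y)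
≡ᵇ-swapℕ p q x y = ≡ᵇ-cong-⇔ {swapℕ p q x} {swapℕ p q y} {x} {y} (swapℕ-injective p q) (cong (swapℕ p q))

≡ᵇ-swapℕ-right : ∀ p q x → (swapℕ p q x ≡ᵇ q) ≡ (x ≡ᵇ p)
≡ᵇ-swapℕ-right p q x =
  trans (cong (swapℕ p q x ≡ᵇ_) (sym (swapℕ-left p q))) (≡ᵇ-swapℕ p q x p)

<ᵇ-swapℕ-below : ∀ {p q k} → p < k → q < k → ∀ x → (swapℕ p q x <ᵇ k) ≡ (x <ᵇ k)
<ᵇ-swapℕ-below {p} {q} p<k q<k x with swapView p q x
... | at-p refl e rewrite e = trans (<⇒<ᵇ-true q<k) (sym (<⇒<ᵇ-true p<k))
... | at-q _ refl e rewrite e = trans (<⇒<ᵇ-true p<k) (sym (<⇒<ᵇ-true q<k))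
... | other _ _ e rewrite e = refl

FalseFrom : ℕ → (ℕ → Bool) → Set
FalseFrom k F = ∀ y → k ≤ y → F y ≡ false

swapℕ-invariant : ∀ {p q k} (F : ℕ → Bool) → k ≤ p → k ≤ q → FalseFrom k F →
                  ∀ x → F (swapℕ p q x) ≡ F x
swapℕ-invariant {p} {q} F k≤p k≤q F↑ x with swapView p q x
... | at-p refl e = trans (cong F e) (trans (F↑ q k≤q) (sym (F↑ p k≤p)))
... | at-q _ refl e = trans (cong F e) (trans (F↑ p k≤p) (sym (F↑ q k≤q)))
... | other _ _ e = cong F e

swap : ∀ {m} → Fin m → Fin m → Fin m → Fin m
swap u w i = if toℕ i ≡ᵇ toℕ u then w else (if toℕ i ≡ᵇ toℕ w then u else i)

toℕ-swap : ∀ {m} (u w i : Fin m) → toℕ (swap u w i) ≡ swapℕ (toℕ u) (toℕ w) (toℕ i)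
toℕ-swap u w i with toℕ i ≡ᵇ toℕ u | toℕ i ≡ᵇ toℕ w
... | true | _ = refl
... | false | true = refl
... | false | false = refl

swap-involutive : ∀ {m} (u w i : Fin m) → swap u w (swap u w i) ≡ i
swap-involutive u w i = toℕ-injective (begin
  toℕ (swap u w (swap u w i))                ≡⟨ toℕ-swap u w (swap u w i) ⟩
  swapℕ (toℕ u) (toℕ w) (toℕ (swap u w i))   ≡⟨ cong (swapℕ (toℕ u) (toℕ w)) (toℕ-swap u w i) ⟩
  swapℕ (toℕ u) (toℕ w) (swapℕ _ _ (toℕ i))  ≡⟨ swapℕ-involutive _ _ _ ⟩
  toℕ i                                      ∎)
  where open ≡-Reasoning

swap-left : ∀ {m} (u w : Fin m) → swap u w u ≡ w
swap-left u w rewrite ≡ᵇ-refl (toℕ u) = refl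

≡ᵇ-toℕ-swap-right : ∀ {m} (u w i : Fin m) → (toℕ (swap u w i) ≡ᵇ toℕ w) ≡ (toℕ i ≡ᵇ toℕ u)
≡ᵇ-toℕ-swap-right u w i =
  trans (cong (_≡ᵇ toℕ w) (toℕ-swap u w i)) (≡ᵇ-swapℕ-right (toℕ u) (toℕ w) (toℕ i))

punchInℕ : ℕ → ℕ → ℕ
punchInℕ x r with r <? x
... | yes _ = r
... | no _ = suc r

punchInℕ-≢ : ∀ x r → punchInℕ x r ≢ x
punchInℕ-≢ x r with r <? x
... | yes r<x = <⇒≢ r<x
... | no r≮x = λ e → r≮x (subst (r <_) e ≤-refl)

punchInℕ-injective : ∀ x {r s} → punchInℕ x r ≡ punchInℕ x s → r ≡ s
punchInℕ-injective x {r} {s} e with r <? x | s <? x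
... | yes _ | yes _ = e
... | no _ | no _ = suc-injective e
... | yes r<x | no s≮x = contradiction (≤-trans (subst (suc s ≤_) (sym e) ≤-refl) (<⇒≤ r<x)) s≮x
... | no r≮x | yes s<x = contradiction (≤-trans (subst (suc r ≤_) e ≤-refl) (<⇒≤ s<x)) r≮x

punchInℕ-< : ∀ x {r m} → r < m → punchInℕ x r < suc m
punchInℕ-< x {r} r<m with r <? x
... | yes _ = ≤-trans r<m (n≤1+n _)
... | no _ = s≤s r<m

avoiding : ∀ {m} → 5 ≤ m → ℕ → Fin 4 → Fin m
avoiding 5≤m x r = fromℕ< (<-≤-trans (punchInℕ-< x (toℕ<n r)) 5≤m)

avoiding-≢ : ∀ {m} (5≤m : 5 ≤ m) x r → toℕ (avoiding 5≤m x r) ≢ x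
avoiding-≢ 5≤m x r = punchInℕ-≢ x (toℕ r) ∘ trans (sym (toℕ-fromℕ< _))

avoiding-injective : ∀ {m} (5≤m : 5 ≤ m) x {r s} → avoiding 5≤m x r ≡ avoiding 5≤m x s → r ≡ s
avoiding-injective 5≤m x e =
  toℕ-injective (punchInℕ-injective x (trans (sym (toℕ-fromℕ< _)) (trans (cong toℕ e) (toℕ-fromℕ< _))))

punchView : ∀ {n} (v w : Fin (suc n)) → v ≡ w ⊎ ∃ λ i → punchIn v i ≡ w
punchView v w with v ≟F w
... | yes v≡w = inj₁ v≡w
... | no v≢w = inj₂ (punchOut v≢w , punchIn-punchOut v≢w)

punchOut-punchIn′ : ∀ {n} (v : Fin (suc n)) (i : Fin n) {v≢i : v ≢ punchIn v i} → punchOut v≢i ≡ i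
punchOut-punchIn′ v i = trans (punchOut-cong v refl) (punchOut-punchIn v)

adj-≗-punchIn : ∀ {n} (G H : GraphOn (suc n)) (v : Fin (suc n)) →
  (∀ i → adj G v (punchIn v i) ≡ adj H v (punchIn v i)) →
  (∀ i j → adj G (punchIn v i) (punchIn v j) ≡ adj H (punchIn v i) (punchIn v j)) →
  ∀ w w′ → adj G w w′ ≡ adj H w w′
adj-≗-punchIn G H v at-v away w w′ with punchView v w | punchView v w′
... | inj₁ refl | inj₁ refl = trans (irrefl G v) (sym (irrefl H v))
... | inj₁ refl | inj₂ (j , refl) = at-v j
... | inj₂ (i , refl) | inj₁ refl = trans (adj-sym G _ v) (trans (at-v i) (adj-sym H v _))
... | inj₂ (i , refl) | inj₂ (j , refl) = away i j

inT-slot : ∀ {n} (x y z i : Fin n) → inT x y z i ≡ true →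
           Σ (Fin 3) λ s → i ≡ lookup (x ∷ y ∷ z ∷ []) s
inT-slot x y z i i∈ with i ≟F x | i ≟F y | i ≟F z
... | yes i≡x | _ | _ = fzero , i≡x
... | no _ | yes i≡y | _ = fsuc fzero , i≡y
... | no _ | no _ | yes i≡z = fsuc (fsuc fzero) , i≡z
... | no _ | no _ | no _ = contradiction i∈ λ ()

no-four-neighbours : ∀ {n} (G : GraphOn (suc n)) (v : Fin (suc n)) (x y z : Fin n) →
  (∀ i → adj G v (punchIn v i) ≡ inT x y z i) →
  (w : Fin 4 → Fin (suc n)) → (∀ r s → w r ≡ w s → r ≡ s) → (∀ r → adj G v (w r) ≡ true) → ⊥
no-four-neighbours G v x y z adj-v w w-inj adj-w = collision (pigeonhole (s≤s ≤-refl) slot)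
  where
  v≢w : ∀ r → v ≢ w r
  v≢w r v≡w = true≢false (trans (sym (adj-w r)) (trans (cong (adj G v) (sym v≡w)) (irrefl G v)))
  nbr : Fin 4 → Fin _
  nbr r = punchOut (v≢w r)
  nbr-in : ∀ r → inT x y z (nbr r) ≡ true
  nbr-in r = trans (sym (adj-v (nbr r))) (trans (cong (adj G v) (punchIn-punchOut (v≢w r))) (adj-w r))
  slot : Fin 4 → Fin 3
  slot r = proj₁ (inT-slot x y z (nbr r) (nbr-in r))
  nbr-slot : ∀ r → nbr r ≡ lookup (x ∷ y ∷ z ∷ []) (slot r)
  nbr-slot r = proj₂ (inT-slot x y z (nbr r) (nbr-in r))
  same-nbr : ∀ r s → slot r ≡ slot s → nbr r ≡ nbr s
  same-nbr r s same = trans (nbr-slot r) (trans (cong (lookup (x ∷ y ∷ z ∷ [])) same) (sym (nbr-slot s)))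
  collision : (∃₂ λ r s → r Fin.< s × slot r ≡ slot s) → ⊥
  collision (r , s , r<s , same) = <⇒≢ r<s (cong toℕ (w-inj r s (begin
    w r                   ≡⟨ punchIn-punchOut (v≢w r) ⟨
    punchIn v (nbr r)     ≡⟨ cong (punchIn v) (same-nbr r s same) ⟩
    punchIn v (nbr s)     ≡⟨ punchIn-punchOut (v≢w s) ⟩
    w s                   ∎)))
    where open ≡-Reasoning

≅⇒vertices≡ : ∀ {n m} {G : GraphOn n} {H : GraphOn m} → (n , G) ≅ (m , H) → n ≡ m
≅⇒vertices≡ (f , _) = ↔⇒≡ (⤖⇒↔ f)

module Model (b c : ℕ) where

  -- Vertex k is the vertex set of G_k: the apex, the parts B and C of K_{1,b,c}, and the
  -- centres of the k Y's that replaced the triangles apex, inB t, inC t for t < k.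
  data Vertex (k : ℕ) : Set where
    apex   : Vertex k
    inB    : Fin b → Vertex k
    inC    : Fin c → Vertex k
    centre : Fin k → Vertex k

  matched : ℕ → ℕ → ℕ → Bool
  matched k i j = (i ≡ᵇ j) ∧ (i <ᵇ k)

  edge : ∀ {k} → Vertex k → Vertex k → Bool
  edge apex       apex       = false
  edge {k} apex   (inB i)    = not (toℕ i <ᵇ k)
  edge {k} apex   (inC j)    = not (toℕ j <ᵇ k)
  edge apex       (centre t) = true
  edge {k} (inB i) apex      = not (toℕ i <ᵇ k)
  edge (inB i)    (inB _)    = false
  edge {k} (inB i) (inC j)   = not (matched k (toℕ i) (toℕ j))
  edge (inB i)    (centre t) = toℕ i ≡ᵇ toℕ t
  edge {k} (inC j) apex      = not (toℕ j <ᵇ k)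
  edge {k} (inC j) (inB i)   = not (matched k (toℕ i) (toℕ j))
  edge (inC _)    (inC _)    = false
  edge (inC j)    (centre t) = toℕ j ≡ᵇ toℕ t
  edge (centre t) apex       = true
  edge (centre t) (inB i)    = toℕ i ≡ᵇ toℕ t
  edge (centre t) (inC j)    = toℕ j ≡ᵇ toℕ t
  edge (centre _) (centre _) = false

  edge-sym : ∀ {k} (a d : Vertex k) → edge a d ≡ edge d a
  edge-sym apex       apex       = refl
  edge-sym apex       (inB _)    = refl
  edge-sym apex       (inC _)    = refl
  edge-sym apex       (centre _) = refl
  edge-sym (inB _)    apex       = refl
  edge-sym (inB _)    (inB _)    = refl
  edge-sym (inB _)    (inC _)    = refl
  edge-sym (inB _)    (centre _) = refl
  edge-sym (inC _)    apex       = refl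
  edge-sym (inC _)    (inB _)    = refl
  edge-sym (inC _)    (inC _)    = refl
  edge-sym (inC _)    (centre _) = refl
  edge-sym (centre _) apex       = refl
  edge-sym (centre _) (inB _)    = refl
  edge-sym (centre _) (inC _)    = refl
  edge-sym (centre _) (centre _) = refl

  edge-irrefl : ∀ {k} (a : Vertex k) → edge a a ≡ false
  edge-irrefl apex       = refl
  edge-irrefl (inB _)    = refl
  edge-irrefl (inC _)    = refl
  edge-irrefl (centre _) = refl

  pullback : ∀ {n k} → (Fin n → Vertex k) → GraphOn n
  pullback f = record
    { adj = λ i j → edge (f i) (f j)
    ; adj-sym = λ i j → edge-sym (f i) (f j)
    ; irrefl = λ i → edge-irrefl (f i)
    }

  record IsModel (k : ℕ) {n} (G : GraphOn n) : Set where
    constructor modelled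
    field
      k≤b       : k ≤ b
      label     : Fin n ↔ Vertex k
      adj-label : ∀ i j → adj G i j ≡ edge (to label i) (to label j)

  IsModel-≅ : ∀ {k n m} {G : GraphOn n} {H : GraphOn m} → IsModel k G → IsModel k H → (n , G) ≅ (m , H)
  IsModel-≅ {G = G} {H} (modelled _ g adj-g) (modelled _ h adj-h) = ↔⇒⤖ (↔-sym h ↔-∘ g) , λ i j → begin
    adj H (from h (to g i)) (from h (to g j))
      ≡⟨ adj-h _ _ ⟩
    edge (to h (from h (to g i))) (to h (from h (to g j)))
      ≡⟨ cong₂ edge (strictlyInverseˡ h _) (strictlyInverseˡ h _) ⟩
    edge (to g i) (to g j)
      ≡⟨ adj-g i j ⟨
    adj G i j ∎
    where open ≡-Reasoning

  record Automorphism (k : ℕ) : Set where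
    field
      σ            : Vertex k → Vertex k
      σ-involutive : ∀ a → σ (σ a) ≡ a
      edge-σ       : ∀ a d → edge (σ a) (σ d) ≡ edge a d

    σ↔ : Vertex k ↔ Vertex k
    σ↔ = mk↔ₛ′ σ σ σ-involutive σ-involutive

  relabel : ∀ {k n} {G : GraphOn n} → IsModel k G → Automorphism k → IsModel k G
  relabel (modelled k≤b g adj-g) s =
    modelled k≤b (σ↔ ↔-∘ g) (λ i j → trans (adj-g i j) (sym (edge-σ (to g i) (to g j))))
    where open Automorphism s

  <ᵇ-falseFrom : ∀ k → FalseFrom k (_<ᵇ k)
  <ᵇ-falseFrom k y k≤y = ≥⇒<ᵇ-false y k k≤y

  matched-falseFromˡ : ∀ k j → FalseFrom k (λ i → matched k i j)
  matched-falseFromˡ k j i k≤i rewrite <ᵇ-falseFrom k i k≤i = ∧-zeroʳ (i ≡ᵇ j)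

  matched-falseFromʳ : ∀ k i → FalseFrom k (matched k i)
  matched-falseFromʳ k i j k≤j with i ≡ᵇ j in e
  ... | false = refl
  ... | true rewrite ≡ᵇ-true⇒≡ i j e = <ᵇ-falseFrom k j k≤j

  ≡ᵇ-falseFrom : ∀ {k} (t : Fin k) → FalseFrom k (_≡ᵇ toℕ t)
  ≡ᵇ-falseFrom {k} t y k≤y = ≢⇒≡ᵇ-false y (toℕ t) (λ y≡t → ≤⇒≯ k≤y (subst (_< k) (sym y≡t) (toℕ<n t)))

  swapFree : ∀ {k} (u w : Fin b) (u′ w′ : Fin c) →
             k ≤ toℕ u → k ≤ toℕ w → k ≤ toℕ u′ → k ≤ toℕ w′ → Automorphism k
  swapFree {k} u w u′ w′ k≤u k≤w k≤u′ k≤w′ =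
    record { σ = σ ; σ-involutive = σ-involutive ; edge-σ = edge-σ }
    where
    σ : Vertex k → Vertex k
    σ (inB i) = inB (swap u w i)
    σ (inC j) = inC (swap u′ w′ j)
    σ a = a

    σ-involutive : ∀ a → σ (σ a) ≡ a
    σ-involutive apex = refl
    σ-involutive (inB i) = cong inB (swap-involutive u w i)
    σ-involutive (inC j) = cong inC (swap-involutive u′ w′ j)
    σ-involutive (centre t) = refl

    onB : ∀ F → FalseFrom k F → ∀ i → F (toℕ (swap u w i)) ≡ F (toℕ i)
    onB F F↑ i = trans (cong F (toℕ-swap u w i)) (swapℕ-invariant F k≤u k≤w F↑ (toℕ i))

    onC : ∀ F → FalseFrom k F → ∀ j → F (toℕ (swap u′ w′ j)) ≡ F (toℕ j)
    onC F F↑ j = trans (cong F (toℕ-swap u′ w′ j)) (swapℕ-invariant F k≤u′ k≤w′ F↑ (toℕ j))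

    onBC : ∀ i j → matched k (toℕ (swap u w i)) (toℕ (swap u′ w′ j)) ≡ matched k (toℕ i) (toℕ j)
    onBC i j = trans (onB (λ x → matched k x (toℕ (swap u′ w′ j))) (matched-falseFromˡ k _) i)
                     (onC (matched k (toℕ i)) (matched-falseFromʳ k _) j)

    edge-σ : ∀ a d → edge (σ a) (σ d) ≡ edge a d
    edge-σ apex       apex       = refl
    edge-σ apex       (inB i)    = cong not (onB (_<ᵇ k) (<ᵇ-falseFrom k) i)
    edge-σ apex       (inC j)    = cong not (onC (_<ᵇ k) (<ᵇ-falseFrom k) j)
    edge-σ apex       (centre _) = refl
    edge-σ (inB i)    apex       = cong not (onB (_<ᵇ k) (<ᵇ-falseFrom k) i)
    edge-σ (inB _)    (inB _)    = refl
    edge-σ (inB i)    (inC j)    = cong not (onBC i j)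
    edge-σ (inB i)    (centre t) = onB (_≡ᵇ toℕ t) (≡ᵇ-falseFrom t) i
    edge-σ (inC j)    apex       = cong not (onC (_<ᵇ k) (<ᵇ-falseFrom k) j)
    edge-σ (inC j)    (inB i)    = cong not (onBC i j)
    edge-σ (inC _)    (inC _)    = refl
    edge-σ (inC j)    (centre t) = onC (_≡ᵇ toℕ t) (≡ᵇ-falseFrom t) j
    edge-σ (centre _) apex       = refl
    edge-σ (centre t) (inB i)    = onB (_≡ᵇ toℕ t) (≡ᵇ-falseFrom t) i
    edge-σ (centre t) (inC j)    = onC (_≡ᵇ toℕ t) (≡ᵇ-falseFrom t) j
    edge-σ (centre _) (centre _) = refl

  swapUsed : ∀ {k} → k ≤ b → k ≤ c → Fin k → Fin k → Automorphism k
  swapUsed {k} k≤b k≤c u w = record { σ = σ ; σ-involutive = σ-involutive ; edge-σ = edge-σ }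
    where
    uB wB : Fin b
    uB = inject≤ u k≤b
    wB = inject≤ w k≤b
    uC wC : Fin c
    uC = inject≤ u k≤c
    wC = inject≤ w k≤c

    σ : Vertex k → Vertex k
    σ apex = apex
    σ (inB i) = inB (swap uB wB i)
    σ (inC j) = inC (swap uC wC j)
    σ (centre t) = centre (swap u w t)

    σ-involutive : ∀ a → σ (σ a) ≡ a
    σ-involutive apex = refl
    σ-involutive (inB i) = cong inB (swap-involutive uB wB i)
    σ-involutive (inC j) = cong inC (swap-involutive uC wC j)
    σ-involutive (centre t) = cong centre (swap-involutive u w t)

    swp : ℕ → ℕ
    swp = swapℕ (toℕ u) (toℕ w)

    onB : ∀ i → toℕ (swap uB wB i) ≡ swp (toℕ i)
    onB i = trans (toℕ-swap uB wB i)
                  (cong₂ (λ p q → swapℕ p q (toℕ i)) (toℕ-inject≤ u k≤b) (toℕ-inject≤ w k≤b))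
    onC : ∀ j → toℕ (swap uC wC j) ≡ swp (toℕ j)
    onC j = trans (toℕ-swap uC wC j)
                  (cong₂ (λ p q → swapℕ p q (toℕ j)) (toℕ-inject≤ u k≤c) (toℕ-inject≤ w k≤c))

    below : ∀ x → (swp x <ᵇ k) ≡ (x <ᵇ k)
    below = <ᵇ-swapℕ-below (toℕ<n u) (toℕ<n w)

    onBC : ∀ x y → matched k (swp x) (swp y) ≡ matched k x y
    onBC x y = cong₂ _∧_ (≡ᵇ-swapℕ _ _ x y) (below x)

    edge-σ : ∀ a d → edge (σ a) (σ d) ≡ edge a d
    edge-σ apex       apex       = refl
    edge-σ apex       (inB i)    rewrite onB i = cong not (below _)
    edge-σ apex       (inC j)    rewrite onC j = cong not (below _)
    edge-σ apex       (centre _) = refl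
    edge-σ (inB i)    apex       rewrite onB i = cong not (below _)
    edge-σ (inB _)    (inB _)    = refl
    edge-σ (inB i)    (inC j)    rewrite onB i | onC j = cong not (onBC _ _)
    edge-σ (inB i)    (centre t) rewrite onB i | toℕ-swap u w t = ≡ᵇ-swapℕ _ _ (toℕ i) (toℕ t)
    edge-σ (inC j)    apex       rewrite onC j = cong not (below _)
    edge-σ (inC j)    (inB i)    rewrite onB i | onC j = cong not (onBC _ _)
    edge-σ (inC _)    (inC _)    = refl
    edge-σ (inC j)    (centre t) rewrite onC j | toℕ-swap u w t = ≡ᵇ-swapℕ _ _ (toℕ j) (toℕ t)
    edge-σ (centre _) apex       = refl
    edge-σ (centre t) (inB i)    rewrite onB i | toℕ-swap u w t = ≡ᵇ-swapℕ _ _ (toℕ i) (toℕ t)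
    edge-σ (centre t) (inC j)    rewrite onC j | toℕ-swap u w t = ≡ᵇ-swapℕ _ _ (toℕ j) (toℕ t)
    edge-σ (centre _) (centre _) = refl

  inB-injective : ∀ {k} {i i′ : Fin b} → inB {k} i ≡ inB i′ → i ≡ i′
  inB-injective refl = refl

  inC-injective : ∀ {k} {j j′ : Fin c} → inC {k} j ≡ inC j′ → j ≡ j′
  inC-injective refl = refl

  centre-injective : ∀ {k} {t t′ : Fin k} → centre t ≡ centre t′ → t ≡ t′
  centre-injective refl = refl

  _==_ : ∀ {k} → Vertex k → Vertex k → Bool
  apex     == apex      = true
  inB i    == inB i′    = toℕ i ≡ᵇ toℕ i′
  inC j    == inC j′    = toℕ j ≡ᵇ toℕ j′
  centre t == centre t′ = toℕ t ≡ᵇ toℕ t′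
  _        == _         = false

  ==-refl : ∀ {k} (a : Vertex k) → (a == a) ≡ true
  ==-refl apex       = refl
  ==-refl (inB i)    = ≡ᵇ-refl (toℕ i)
  ==-refl (inC j)    = ≡ᵇ-refl (toℕ j)
  ==-refl (centre t) = ≡ᵇ-refl (toℕ t)

  ==⇒≡ : ∀ {k} (a d : Vertex k) → (a == d) ≡ true → a ≡ d
  ==⇒≡ apex       apex        _ = refl
  ==⇒≡ (inB i)    (inB i′)    e = cong inB (toℕ-injective (≡ᵇ-true⇒≡ _ _ e))
  ==⇒≡ (inC j)    (inC j′)    e = cong inC (toℕ-injective (≡ᵇ-true⇒≡ _ _ e))
  ==⇒≡ (centre t) (centre t′) e = cong centre (toℕ-injective (≡ᵇ-true⇒≡ _ _ e))
  ==⇒≡ apex       (inB _)    ()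
  ==⇒≡ apex       (inC _)    ()
  ==⇒≡ apex       (centre _) ()
  ==⇒≡ (inB _)    apex       ()
  ==⇒≡ (inB _)    (inC _)    ()
  ==⇒≡ (inB _)    (centre _) ()
  ==⇒≡ (inC _)    apex       ()
  ==⇒≡ (inC _)    (inB _)    ()
  ==⇒≡ (inC _)    (centre _) ()
  ==⇒≡ (centre _) apex       ()
  ==⇒≡ (centre _) (inB _)    ()
  ==⇒≡ (centre _) (inC _)    ()

  ≟-label : ∀ {n k} (g : Fin n ↔ Vertex k) (i j : Fin n) → ⌊ i ≟F j ⌋ ≡ (to g i == to g j)
  ≟-label g i j with i ≟F j
  ... | yes refl = sym (==-refl (to g i))
  ... | no i≢j with to g i == to g j in e
  ...   | true = contradiction (Injection.injective (↔⇒↣ g) (==⇒≡ _ _ e)) i≢j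
  ...   | false = refl

  triple : ∀ {k} → ℕ → ℕ → Vertex k → Bool
  triple p q apex       = true
  triple p q (inB i)    = toℕ i ≡ᵇ p
  triple p q (inC j)    = toℕ j ≡ᵇ q
  triple p q (centre _) = false

  inT-label : ∀ {n k} (g : Fin n ↔ Vertex k) (x y z i : Fin n) →
              inT x y z i ≡ ((to g i == to g x) ∨ (to g i == to g y) ∨ (to g i == to g z))
  inT-label g x y z i = cong₂ _∨_ (≟-label g i x) (cong₂ _∨_ (≟-label g i y) (≟-label g i z))

  -- Adding and removing the newest Y

  up : ∀ {k} → Vertex k → Vertex (suc k)
  up apex       = apex
  up (inB i)    = inB i
  up (inC j)    = inC j
  up (centre t) = centre (inject₁ t)

  new : ∀ k → Vertex (suc k)
  new k = centre (fromℕ k)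

  up≢new : ∀ {k} (a : Vertex k) → up a ≢ new k
  up≢new (centre t) e = fromℕ≢inject₁ (sym (centre-injective e))

  new? : ∀ {k} (a : Vertex (suc k)) → Dec (a ≡ new k)
  new? apex       = no λ ()
  new? (inB _)    = no λ ()
  new? (inC _)    = no λ ()
  new? (centre t) with t ≟F fromℕ _
  ... | yes refl = yes refl
  ... | no t≢new = no (t≢new ∘ centre-injective)

  lower : ∀ {k} (a : Vertex (suc k)) → a ≢ new k → Vertex k
  lower apex          _     = apex
  lower (inB i)       _     = inB i
  lower (inC j)       _     = inC j
  lower {k} (centre t) a≢new =
    centre (lower₁ t λ k≡t → a≢new (cong centre (toℕ-injective (trans (sym k≡t) (sym (toℕ-fromℕ k))))))

  up-lower : ∀ {k} (a : Vertex (suc k)) (a≢new : a ≢ new k) → up (lower a a≢new) ≡ a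
  up-lower apex       _ = refl
  up-lower (inB _)    _ = refl
  up-lower (inC _)    _ = refl
  up-lower (centre t) _ = cong centre (inject₁-lower₁ t _)

  lower-up : ∀ {k} {x : Vertex (suc k)} (a : Vertex k) (x≢new : x ≢ new k) → x ≡ up a →
             lower x x≢new ≡ a
  lower-up apex       _ refl = refl
  lower-up (inB _)    _ refl = refl
  lower-up (inC _)    _ refl = refl
  lower-up (centre t) _ refl = cong centre (lower₁-inject₁′ t _)

  module Extend {n k} (v : Fin (suc n)) (h : Fin n ↔ Vertex k) where
    label : Fin (suc n) → Vertex (suc k)
    label w with v ≟F w
    ... | yes _   = new k
    ... | no v≢w = up (to h (punchOut v≢w))

    label-v : label v ≡ new k
    label-v with v ≟F v
    ... | yes _   = refl
    ... | no v≢v = contradiction refl v≢v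

    label-punchIn : ∀ i → label (punchIn v i) ≡ up (to h i)
    label-punchIn i with v ≟F punchIn v i
    ... | yes v≡ = contradiction (sym v≡) (punchInᵢ≢i v i)
    ... | no _    = cong (up ∘ to h) (punchOut-punchIn′ v i)

    unlabel : Vertex (suc k) → Fin (suc n)
    unlabel a with new? a
    ... | yes _     = v
    ... | no a≢new = punchIn v (from h (lower a a≢new))

    unlabel-new : unlabel (new k) ≡ v
    unlabel-new with new? (new k)
    ... | yes _      = refl
    ... | no ≢new = contradiction refl ≢new

    unlabel-up : ∀ a → unlabel (up a) ≡ punchIn v (from h a)
    unlabel-up a with new? (up a)
    ... | yes ≡new = contradiction ≡new (up≢new a)
    ... | no ≢new  = cong (punchIn v ∘ from h) (lower-up a ≢new refl)

    label-unlabel : ∀ a → label (unlabel a) ≡ a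
    label-unlabel a with new? a
    ... | yes refl  = label-v
    ... | no a≢new = trans (label-punchIn _) (trans (cong up (strictlyInverseˡ h _)) (up-lower a a≢new))

    unlabel-label : ∀ w → unlabel (label w) ≡ w
    unlabel-label w with punchView v w
    ... | inj₁ refl = trans (cong unlabel label-v) unlabel-new
    ... | inj₂ (i , refl) = begin
      unlabel (label (punchIn v i)) ≡⟨ cong unlabel (label-punchIn i) ⟩
      unlabel (up (to h i))         ≡⟨ unlabel-up (to h i) ⟩
      punchIn v (from h (to h i))   ≡⟨ cong (punchIn v) (strictlyInverseʳ h i) ⟩
      punchIn v i                   ∎
      where open ≡-Reasoning

    iso : Fin (suc n) ↔ Vertex (suc k)
    iso = mk↔ₛ′ label unlabel label-unlabel unlabel-label

  module Restrict {n k} (v : Fin (suc n)) (g : Fin (suc n) ↔ Vertex (suc k)) (g-v : to g v ≡ new k) where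
    ≢new : ∀ i → to g (punchIn v i) ≢ new k
    ≢new i e = punchInᵢ≢i v i (Injection.injective (↔⇒↣ g) (trans e (sym g-v)))

    label : Fin n → Vertex k
    label i = lower (to g (punchIn v i)) (≢new i)

    up-label : ∀ i → up (label i) ≡ to g (punchIn v i)
    up-label i = up-lower _ (≢new i)

    v≢from-up : ∀ a → v ≢ from g (up a)
    v≢from-up a e = up≢new a (trans (sym (strictlyInverseˡ g (up a))) (trans (cong (to g) (sym e)) g-v))

    unlabel : Vertex k → Fin n
    unlabel a = punchOut (v≢from-up a)

    label-unlabel : ∀ a → label (unlabel a) ≡ a
    label-unlabel a = lower-up a (≢new _)
      (trans (cong (to g) (punchIn-punchOut (v≢from-up a))) (strictlyInverseˡ g (up a)))

    unlabel-label : ∀ i → unlabel (label i) ≡ i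
    unlabel-label i = trans
      (punchOut-cong v (trans (cong (from g) (up-label i)) (strictlyInverseʳ g (punchIn v i))))
      (punchOut-punchIn v)

    iso : Fin n ↔ Vertex k
    iso = mk↔ₛ′ label unlabel label-unlabel unlabel-label

  edge-new : ∀ {k} (a : Vertex k) → edge (new k) (up a) ≡ triple k k a
  edge-new apex            = refl
  edge-new {k} (inB i)    rewrite toℕ-fromℕ k = refl
  edge-new {k} (inC j)    rewrite toℕ-fromℕ k = refl
  edge-new (centre _)      = refl

  matched-suc : ∀ k i j → matched (suc k) i j ≡ (matched k i j ∨ ((i ≡ᵇ k) ∧ (j ≡ᵇ k)))
  matched-suc k i j with i ≡ᵇ j in i≡ᵇj
  ... | true rewrite ≡ᵇ-true⇒≡ i j i≡ᵇj | <ᵇ-suc j k | ∧-idem (j ≡ᵇ k) = refl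
  ... | false with i ≡ᵇ k in i≡ᵇk
  ...   | false = refl
  ...   | true rewrite ≡ᵇ-true⇒≡ i k i≡ᵇk | ≡ᵇ-sym j k | i≡ᵇj = refl

  -- G_{k+1} minus its newest centre is G_k minus the edges of the triangle apex, inB k, inC k.
  edge-up : ∀ {k} (a d : Vertex k) → edge (up a) (up d) ≡ (edge a d ∧ not (triple k k a ∧ triple k k d))
  edge-up apex       apex       = refl
  edge-up {k} apex   (inB i)    rewrite <ᵇ-suc (toℕ i) k = not-∨ (toℕ i <ᵇ k) (toℕ i ≡ᵇ k)
  edge-up {k} apex   (inC j)    rewrite <ᵇ-suc (toℕ j) k = not-∨ (toℕ j <ᵇ k) (toℕ j ≡ᵇ k)
  edge-up apex       (centre _) = refl
  edge-up {k} (inB i) apex      rewrite <ᵇ-suc (toℕ i) k | ∧-identityʳ (toℕ i ≡ᵇ k) =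
    not-∨ (toℕ i <ᵇ k) (toℕ i ≡ᵇ k)
  edge-up (inB _)    (inB _)    = refl
  edge-up {k} (inB i) (inC j)   =
    trans (cong not (matched-suc k (toℕ i) (toℕ j))) (not-∨ (matched k (toℕ i) (toℕ j)) _)
  edge-up {k} (inB i) (centre t) rewrite toℕ-inject₁ t | ∧-zeroʳ (toℕ i ≡ᵇ k) = sym (∧-identityʳ _)
  edge-up {k} (inC j) apex      rewrite <ᵇ-suc (toℕ j) k | ∧-identityʳ (toℕ j ≡ᵇ k) =
    not-∨ (toℕ j <ᵇ k) (toℕ j ≡ᵇ k)
  edge-up {k} (inC j) (inB i)   rewrite ∧-comm (toℕ j ≡ᵇ k) (toℕ i ≡ᵇ k) =
    trans (cong not (matched-suc k (toℕ i) (toℕ j))) (not-∨ (matched k (toℕ i) (toℕ j)) _)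
  edge-up (inC _)    (inC _)    = refl
  edge-up {k} (inC j) (centre t) rewrite toℕ-inject₁ t | ∧-zeroʳ (toℕ j ≡ᵇ k) = sym (∧-identityʳ _)
  edge-up (centre _) apex       = refl
  edge-up (centre t) (inB _)    rewrite toℕ-inject₁ t = sym (∧-identityʳ _)
  edge-up (centre t) (inC _)    rewrite toℕ-inject₁ t = sym (∧-identityʳ _)
  edge-up (centre _) (centre _) = refl

  edge-triple : ∀ {k} (a d : Vertex k) → triple k k a ≡ true → triple k k d ≡ true →
                edge a d ≡ not (a == d)
  edge-triple apex apex _ _ = refl
  edge-triple {k} apex (inB i) _ e rewrite ≡ᵇ-true⇒≡ (toℕ i) k e | <ᵇ-falseFrom k k ≤-refl = refl
  edge-triple {k} apex (inC j) _ e rewrite ≡ᵇ-true⇒≡ (toℕ j) k e | <ᵇ-falseFrom k k ≤-refl = refl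
  edge-triple {k} (inB i) apex e _ rewrite ≡ᵇ-true⇒≡ (toℕ i) k e | <ᵇ-falseFrom k k ≤-refl = refl
  edge-triple {k} (inB i) (inB i′) e e′
    rewrite ≡ᵇ-true⇒≡ (toℕ i) k e | ≡ᵇ-true⇒≡ (toℕ i′) k e′ | ≡ᵇ-refl k = refl
  edge-triple {k} (inB i) (inC j) e e′
    rewrite ≡ᵇ-true⇒≡ (toℕ i) k e | ≡ᵇ-true⇒≡ (toℕ j) k e′ | <ᵇ-falseFrom k k ≤-refl | ≡ᵇ-refl k = refl
  edge-triple {k} (inC j) apex e _ rewrite ≡ᵇ-true⇒≡ (toℕ j) k e | <ᵇ-falseFrom k k ≤-refl = refl
  edge-triple {k} (inC j) (inB i) e e′
    rewrite ≡ᵇ-true⇒≡ (toℕ j) k e | ≡ᵇ-true⇒≡ (toℕ i) k e′ | <ᵇ-falseFrom k k ≤-refl | ≡ᵇ-refl k = refl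
  edge-triple {k} (inC j) (inC j′) e e′
    rewrite ≡ᵇ-true⇒≡ (toℕ j) k e | ≡ᵇ-true⇒≡ (toℕ j′) k e′ | ≡ᵇ-refl k = refl
  edge-triple apex       (centre _) _ ()
  edge-triple (inB _)    (centre _) _ ()
  edge-triple (inC _)    (centre _) _ ()
  edge-triple (centre _) _          ()

  edge-up-restore : ∀ {k} (a d : Vertex k) →
    (edge (up a) (up d) ∨ (triple k k a ∧ (triple k k d ∧ not (a == d)))) ≡ edge a d
  edge-up-restore {k} a d rewrite edge-up a d =
    restore (edge a d) (triple k k a) (triple k k d) (a == d) (edge-triple a d)
    where
    restore : ∀ e p q same → (p ≡ true → q ≡ true → e ≡ not same) →
              ((e ∧ not (p ∧ q)) ∨ (p ∧ (q ∧ not same))) ≡ e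
    restore e true  true  same h rewrite h refl refl with same
    ... | true  = refl
    ... | false = refl
    restore e true  false _ _ rewrite ∧-identityʳ e = ∨-identityʳ e
    restore e false _     _ _ rewrite ∧-identityʳ e = ∨-identityʳ e

  -- Triangles of G_k and ΔY moves

  among : ∀ {k} → Vertex k → Vertex k → Vertex k → Vertex k → Bool
  among a d e w = (w == a) ∨ (w == d) ∨ (w == e)

  record FreeTriangle {k} (a d e : Vertex k) : Set where
    field
      β       : Fin b
      γ       : Fin c
      k≤β     : k ≤ toℕ β
      k≤γ     : k ≤ toℕ γ
      members : ∀ w → among a d e w ≡ triple (toℕ β) (toℕ γ) w

  free-index : ∀ {m k} (i : Fin m) → not (toℕ i <ᵇ k) ≡ true → k ≤ toℕ i
  free-index {k = k} i e = <ᵇ-false⇒≥ (toℕ i) k (not-injective e)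

  free≢centre : ∀ {m k} (i : Fin m) (t : Fin k) → not (toℕ i <ᵇ k) ≡ true → (toℕ i ≡ᵇ toℕ t) ≡ true → ⊥
  free≢centre i t free i≡t = ≤⇒≯ (free-index i free) (subst (_< _) (sym (≡ᵇ-true⇒≡ _ _ i≡t)) (toℕ<n t))

  ¬matched-legs : ∀ {k} (i j : ℕ) (t : Fin k) → not (matched k i j) ≡ true →
                  (i ≡ᵇ toℕ t) ≡ true → (j ≡ᵇ toℕ t) ≡ true → ⊥
  ¬matched-legs {k} i j t unmatched i≡t j≡t
    rewrite ≡ᵇ-true⇒≡ i (toℕ t) i≡t | ≡ᵇ-true⇒≡ j (toℕ t) j≡t | ≡ᵇ-refl (toℕ t) | <⇒<ᵇ-true (toℕ<n t)
    = true≢false (sym unmatched)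

  freeTriangle : ∀ {k} {a d e : Vertex k} (β : Fin b) (γ : Fin c) → k ≤ toℕ β → k ≤ toℕ γ →
                 (∀ w → among a d e w ≡ among apex (inB β) (inC γ) w) → FreeTriangle a d e
  freeTriangle β γ k≤β k≤γ reorder =
    record { β = β ; γ = γ ; k≤β = k≤β ; k≤γ = k≤γ ; members = λ w → trans (reorder w) (canonical w) }
    where
    canonical : ∀ w → among apex (inB β) (inC γ) w ≡ triple (toℕ β) (toℕ γ) w
    canonical apex       = refl
    canonical (inB i)    = ∨-identityʳ _
    canonical (inC _)    = refl
    canonical (centre _) = refl

  classify-triangle : ∀ {k} (a d e : Vertex k) → edge a d ≡ true → edge d e ≡ true → edge a e ≡ true →
                      FreeTriangle a d e
  classify-triangle apex       apex       _          () _  _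
  classify-triangle (inB _)    (inB _)    _          () _  _
  classify-triangle (inC _)    (inC _)    _          () _  _
  classify-triangle (centre _) (centre _) _          () _  _
  classify-triangle _          apex       apex       _  () _
  classify-triangle _          (inB _)    (inB _)    _  () _
  classify-triangle _          (inC _)    (inC _)    _  () _
  classify-triangle _          (centre _) (centre _) _  () _
  classify-triangle apex       _          apex       _  _  ()
  classify-triangle (inB _)    _          (inB _)    _  _  ()
  classify-triangle (inC _)    _          (inC _)    _  _  ()
  classify-triangle (centre _) _          (centre _) _  _  ()
  classify-triangle apex    (inB β) (inC γ) ad de ae =
    freeTriangle β γ (free-index β ad) (free-index γ ae)
      λ _ → refl
  classify-triangle apex    (inC γ) (inB β) ad de ae =
    freeTriangle β γ (free-index β ae) (free-index γ ad)
      λ w → x∙yz≈x∙zy (w == apex) (w == inC γ) (w == inB β)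
  classify-triangle (inB β) apex    (inC γ) ad de ae =
    freeTriangle β γ (free-index β ad) (free-index γ de)
      λ w → x∙yz≈y∙xz (w == inB β) (w == apex) (w == inC γ)
  classify-triangle (inB β) (inC γ) apex    ad de ae =
    freeTriangle β γ (free-index β ae) (free-index γ de)
      λ w → x∙yz≈z∙xy (w == inB β) (w == inC γ) (w == apex)
  classify-triangle (inC γ) apex    (inB β) ad de ae =
    freeTriangle β γ (free-index β de) (free-index γ ad)
      λ w → x∙yz≈y∙zx (w == inC γ) (w == apex) (w == inB β)
  classify-triangle (inC γ) (inB β) apex    ad de ae =
    freeTriangle β γ (free-index β de) (free-index γ ae)
      λ w → x∙yz≈z∙yx (w == inC γ) (w == inB β) (w == apex)
  classify-triangle apex       (inB i)    (centre t) ad de ae = ⊥-elim (free≢centre i t ad de)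
  classify-triangle apex       (centre t) (inB i)    ad de ae = ⊥-elim (free≢centre i t ae de)
  classify-triangle (inB i)    apex       (centre t) ad de ae = ⊥-elim (free≢centre i t ad ae)
  classify-triangle (inB i)    (centre t) apex       ad de ae = ⊥-elim (free≢centre i t ae ad)
  classify-triangle (centre t) apex       (inB i)    ad de ae = ⊥-elim (free≢centre i t de ae)
  classify-triangle (centre t) (inB i)    apex       ad de ae = ⊥-elim (free≢centre i t de ad)
  classify-triangle apex       (inC j)    (centre t) ad de ae = ⊥-elim (free≢centre j t ad de)
  classify-triangle apex       (centre t) (inC j)    ad de ae = ⊥-elim (free≢centre j t ae de)
  classify-triangle (inC j)    apex       (centre t) ad de ae = ⊥-elim (free≢centre j t ad ae)
  classify-triangle (inC j)    (centre t) apex       ad de ae = ⊥-elim (free≢centre j t ae ad)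
  classify-triangle (centre t) apex       (inC j)    ad de ae = ⊥-elim (free≢centre j t de ae)
  classify-triangle (centre t) (inC j)    apex       ad de ae = ⊥-elim (free≢centre j t de ad)
  classify-triangle (inB i)    (inC j)    (centre t) ad de ae =
    ⊥-elim (¬matched-legs (toℕ i) (toℕ j) t ad ae de)
  classify-triangle (inB i)    (centre t) (inC j)    ad de ae =
    ⊥-elim (¬matched-legs (toℕ i) (toℕ j) t ae ad de)
  classify-triangle (inC j)    (inB i)    (centre t) ad de ae =
    ⊥-elim (¬matched-legs (toℕ i) (toℕ j) t ad de ae)
  classify-triangle (inC j)    (centre t) (inB i)    ad de ae =
    ⊥-elim (¬matched-legs (toℕ i) (toℕ j) t ae de ad)
  classify-triangle (centre t) (inB i)    (inC j)    ad de ae =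
    ⊥-elim (¬matched-legs (toℕ i) (toℕ j) t de ad ae)
  classify-triangle (centre t) (inC j)    (inB i)    ad de ae =
    ⊥-elim (¬matched-legs (toℕ i) (toℕ j) t de ae ad)

  ΔY-preserves : ∀ {k n} {G : GraphOn n} {H : GraphOn (suc n)} → IsModel k G → ΔY G H → IsModel (suc k) H
  ΔY-preserves {k} {n} {G} {H} M (v , x , y , z , _ , (xy , yz , xz) , adj-v , adj-punchIn) =
    modelled k<b iso (adj-≗-punchIn H (pullback label) v at-v away)
    where
    open IsModel M using () renaming (label to g; adj-label to adj-g)
    open FreeTriangle (classify-triangle (to g x) (to g y) (to g z)
      (trans (sym (adj-g x y)) xy) (trans (sym (adj-g y z)) yz) (trans (sym (adj-g x z)) xz))
    k<b : k < b
    k<b = ≤-<-trans k≤β (toℕ<n β)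
    k<c : k < c
    k<c = ≤-<-trans k≤γ (toℕ<n γ)
    kB : Fin b
    kB = fromℕ< k<b
    kC : Fin c
    kC = fromℕ< k<c
    s : Automorphism k
    s = swapFree β kB γ kC k≤β (≤-reflexive (sym (toℕ-fromℕ< k<b)))
                           k≤γ (≤-reflexive (sym (toℕ-fromℕ< k<c)))
    open Automorphism s using (σ)
    open IsModel (relabel M s) using () renaming (label to g′; adj-label to adj-g′)
    open Extend v g′

    triple-σ : ∀ w → triple k k (σ w) ≡ triple (toℕ β) (toℕ γ) w
    triple-σ apex       = refl
    triple-σ (inB i)    =
      trans (cong (toℕ (swap β kB i) ≡ᵇ_) (sym (toℕ-fromℕ< k<b))) (≡ᵇ-toℕ-swap-right β kB i)
    triple-σ (inC j)    =
      trans (cong (toℕ (swap γ kC j) ≡ᵇ_) (sym (toℕ-fromℕ< k<c))) (≡ᵇ-toℕ-swap-right γ kC j)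
    triple-σ (centre _) = refl

    in-triangle : ∀ i → inT x y z i ≡ triple k k (to g′ i)
    in-triangle i = trans (inT-label g x y z i) (trans (members (to g i)) (sym (triple-σ (to g i))))

    at-v : ∀ i → adj H v (punchIn v i) ≡ edge (label v) (label (punchIn v i))
    at-v i = begin
      adj H v (punchIn v i)                ≡⟨ adj-v i ⟩
      inT x y z i                          ≡⟨ in-triangle i ⟩
      triple k k (to g′ i)                 ≡⟨ edge-new (to g′ i) ⟨
      edge (new k) (up (to g′ i))          ≡⟨ cong₂ edge label-v (label-punchIn i) ⟨
      edge (label v) (label (punchIn v i)) ∎
      where open ≡-Reasoning

    away : ∀ i j → adj H (punchIn v i) (punchIn v j) ≡ edge (label (punchIn v i)) (label (punchIn v j))
    away i j = begin
      adj H (punchIn v i) (punchIn v j)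
        ≡⟨ adj-punchIn i j ⟩
      adj G i j ∧ not (inT x y z i ∧ inT x y z j)
        ≡⟨ cong₂ (λ p q → p ∧ not q) (adj-g′ i j) (cong₂ _∧_ (in-triangle i) (in-triangle j)) ⟩
      edge (to g′ i) (to g′ j) ∧ not (triple k k (to g′ i) ∧ triple k k (to g′ j))
        ≡⟨ edge-up (to g′ i) (to g′ j) ⟨
      edge (up (to g′ i)) (up (to g′ j))
        ≡⟨ cong₂ edge (label-punchIn i) (label-punchIn j) ⟨
      edge (label (punchIn v i)) (label (punchIn v j)) ∎
      where open ≡-Reasoning

  ΔY-exists : ∀ {k n} {G : GraphOn n} → IsModel k G → k < b → k < c → Σ (GraphOn (suc n)) (ΔY G)
  ΔY-exists {k} {n} {G} (modelled _ g adj-g) k<b k<c =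
    H , fzero , x , y , z , (x≢y , y≢z , x≢z) , (xy , yz , xz) , (λ _ → refl) , (λ _ _ → refl)
    where
    kB : Fin b
    kB = fromℕ< k<b
    kC : Fin c
    kC = fromℕ< k<c
    x y z : Fin n
    x = from g apex
    y = from g (inB kB)
    z = from g (inC kC)

    adjH : Fin (suc n) → Fin (suc n) → Bool
    adjH fzero    fzero    = false
    adjH fzero    (fsuc j) = inT x y z j
    adjH (fsuc i) fzero    = inT x y z i
    adjH (fsuc i) (fsuc j) = adj G i j ∧ not (inT x y z i ∧ inT x y z j)

    adjH-sym : ∀ i j → adjH i j ≡ adjH j i
    adjH-sym fzero    fzero    = refl
    adjH-sym fzero    (fsuc _) = refl
    adjH-sym (fsuc _) fzero    = refl
    adjH-sym (fsuc i) (fsuc j) = cong₂ (λ p q → p ∧ not q) (adj-sym G i j) (∧-comm (inT x y z i) (inT x y z j))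

    adjH-irrefl : ∀ i → adjH i i ≡ false
    adjH-irrefl fzero = refl
    adjH-irrefl (fsuc i) rewrite irrefl G i = refl

    H : GraphOn (suc n)
    H = record { adj = adjH ; adj-sym = adjH-sym ; irrefl = adjH-irrefl }

    from-≢ : ∀ {a d} → a ≢ d → from g a ≢ from g d
    from-≢ a≢d e = a≢d (trans (sym (strictlyInverseˡ g _)) (trans (cong (to g) e) (strictlyInverseˡ g _)))
    x≢y : x ≢ y
    x≢y = from-≢ λ ()
    y≢z : y ≢ z
    y≢z = from-≢ λ ()
    x≢z : x ≢ z
    x≢z = from-≢ λ ()

    adj-from : ∀ a d → adj G (from g a) (from g d) ≡ edge a d
    adj-from a d = trans (adj-g _ _) (cong₂ edge (strictlyInverseˡ g a) (strictlyInverseˡ g d))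

    k≮k : (k <ᵇ k) ≡ false
    k≮k = <ᵇ-falseFrom k k ≤-refl

    xy : adj G x y ≡ true
    xy rewrite adj-from apex (inB kB) | toℕ-fromℕ< k<b | k≮k = refl
    xz : adj G x z ≡ true
    xz rewrite adj-from apex (inC kC) | toℕ-fromℕ< k<c | k≮k = refl
    yz : adj G y z ≡ true
    yz rewrite adj-from (inB kB) (inC kC) | toℕ-fromℕ< k<b | toℕ-fromℕ< k<c | ≡ᵇ-refl k | k≮k = refl

  -- Degrees in G_k and YΔ moves

  FourNeighbours : ∀ {k} → Vertex k → Set
  FourNeighbours {k} a =
    Σ (Fin 4 → Vertex k) λ w → (∀ r s → w r ≡ w s → r ≡ s) × (∀ r → edge a (w r) ≡ true)

  apex-four : 5 ≤ b → ∀ {k} → FourNeighbours {k} apex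
  apex-four 5≤b {k} =
    (λ r → pick r (toℕ r <? k)) ,
    (λ r s → pick-injective r s (toℕ r <? k) (toℕ s <? k)) ,
    (λ r → pick-adjacent r (toℕ r <? k))
    where
    r<b : (r : Fin 4) → toℕ r < b
    r<b r = ≤-trans (toℕ<n r) (≤-trans (n≤1+n 4) 5≤b)

    pick : (r : Fin 4) → Dec (toℕ r < k) → Vertex k
    pick r (yes r<k) = centre (fromℕ< r<k)
    pick r (no _)    = inB (fromℕ< (r<b r))

    pick-adjacent : ∀ r d → edge apex (pick r d) ≡ true
    pick-adjacent r (yes _)   = refl
    pick-adjacent r (no r≮k) rewrite toℕ-fromℕ< (r<b r) | ≥⇒<ᵇ-false (toℕ r) k (≮⇒≥ r≮k) = refl

    pick-injective : ∀ r s d d′ → pick r d ≡ pick s d′ → r ≡ s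
    pick-injective r s (yes r<k) (yes s<k) e =
      toℕ-injective (trans (sym (toℕ-fromℕ< r<k)) (trans (cong toℕ (centre-injective e)) (toℕ-fromℕ< s<k)))
    pick-injective r s (no _) (no _) e =
      toℕ-injective (trans (sym (toℕ-fromℕ< (r<b r))) (trans (cong toℕ (inB-injective e)) (toℕ-fromℕ< (r<b s))))

  inB-four : 5 ≤ c → ∀ {k} (i : Fin b) → FourNeighbours {k} (inB i)
  inB-four 5≤c {k} i =
    (λ r → inC (avoiding 5≤c (toℕ i) r)) ,
    (λ r s e → avoiding-injective 5≤c (toℕ i) (inC-injective e)) ,
    (λ r → cong (λ p → not (p ∧ (toℕ i <ᵇ k))) (≢⇒≡ᵇ-false _ _ (avoiding-≢ 5≤c (toℕ i) r ∘ sym)))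

  inC-four : 5 ≤ b → ∀ {k} (j : Fin c) → FourNeighbours {k} (inC j)
  inC-four 5≤b {k} j =
    (λ r → inB (avoiding 5≤b (toℕ j) r)) ,
    (λ r s e → avoiding-injective 5≤b (toℕ j) (inB-injective e)) ,
    (λ r → cong (λ p → not (p ∧ (toℕ (avoiding 5≤b (toℕ j) r) <ᵇ k)))
                (≢⇒≡ᵇ-false _ _ (avoiding-≢ 5≤b (toℕ j) r)))

  no-four-at-degree-three : ∀ {k n} {G : GraphOn (suc n)} (M : IsModel k G)
    (v : Fin (suc n)) (x y z : Fin n) →
    (∀ i → adj G v (punchIn v i) ≡ inT x y z i) →
    ∀ {a} → to (IsModel.label M) v ≡ a → ¬ FourNeighbours a
  no-four-at-degree-three {G = G} (modelled _ g adj-g) v x y z adj-v refl (w , w-inj , adj-w) =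
    no-four-neighbours G v x y z adj-v (from g ∘ w)
      (λ r s e → w-inj r s (trans (sym (strictlyInverseˡ g (w r)))
                                  (trans (cong (to g) e) (strictlyInverseˡ g (w s)))))
      (λ r → trans (adj-g v _) (trans (cong (edge (to g v)) (strictlyInverseˡ g (w r))) (adj-w r)))

  YΔ-centre : ∀ {k n} {G : GraphOn (suc n)} {H : GraphOn n} → 5 ≤ b → 5 ≤ c →
              (M : IsModel k G) (Y : YΔ G H) → ∃ λ t → to (IsModel.label M) (proj₁ Y) ≡ centre t
  YΔ-centre 5≤b 5≤c M@(modelled _ g _) (v , x , y , z , _ , adj-v , _) with to g v in g-v
  ... | apex     = ⊥-elim (no-four-at-degree-three M v x y z adj-v g-v (apex-four 5≤b))
  ... | inB i    = ⊥-elim (no-four-at-degree-three M v x y z adj-v g-v (inB-four 5≤c i))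
  ... | inC j    = ⊥-elim (no-four-at-degree-three M v x y z adj-v g-v (inC-four 5≤b j))
  ... | centre t = t , refl

  YΔ-at-centre : ∀ {k n} {G : GraphOn (suc n)} {H : GraphOn n} → b ≤ c →
                 (M : IsModel k G) (Y : YΔ G H) (t : Fin k) → to (IsModel.label M) (proj₁ Y) ≡ centre t →
                 ∃ λ k′ → IsModel k′ H
  YΔ-at-centre {suc k} {n} {G} {H} b≤c M (v , x , y , z , _ , adj-v , _ , adj-H) t g-v =
    k , modelled (<⇒≤ k≤b) iso adj-H′
    where
    open IsModel M using (k≤b)
    s : Automorphism (suc k)
    s = swapUsed k≤b (≤-trans k≤b b≤c) t (fromℕ k)
    open IsModel (relabel M s) using () renaming (label to g′; adj-label to adj-g′)
    g′-v : to g′ v ≡ new k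
    g′-v = trans (cong (Automorphism.σ s) g-v) (cong centre (swap-left t (fromℕ k)))
    open Restrict v g′ g′-v

    in-triangle : ∀ i → inT x y z i ≡ triple k k (label i)
    in-triangle i = begin
      inT x y z i                             ≡⟨ adj-v i ⟨
      adj G v (punchIn v i)                   ≡⟨ adj-g′ v (punchIn v i) ⟩
      edge (to g′ v) (to g′ (punchIn v i))    ≡⟨ cong₂ edge g′-v (sym (up-label i)) ⟩
      edge (new k) (up (label i))             ≡⟨ edge-new (label i) ⟩
      triple k k (label i)                    ∎
      where open ≡-Reasoning

    adj-H′ : ∀ i j → adj H i j ≡ edge (label i) (label j)
    adj-H′ i j = begin
      adj H i j
        ≡⟨ adj-H i j ⟩
      adj G (punchIn v i) (punchIn v j) ∨ (inT x y z i ∧ inT x y z j ∧ not ⌊ i ≟F j ⌋)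
        ≡⟨ cong₂ _∨_ (trans (adj-g′ _ _) (sym (cong₂ edge (up-label i) (up-label j))))
                     (cong₂ _∧_ (in-triangle i) (cong₂ _∧_ (in-triangle j) (cong not (≟-label iso i j)))) ⟩
      edge (up (label i)) (up (label j))
        ∨ (triple k k (label i) ∧ triple k k (label j) ∧ not (label i == label j))
        ≡⟨ edge-up-restore (label i) (label j) ⟩
      edge (label i) (label j) ∎
      where open ≡-Reasoning

  YΔ-preserves : ∀ {k n} {G : GraphOn (suc n)} {H : GraphOn n} → 5 ≤ b → b ≤ c →
                 IsModel k G → YΔ G H → ∃ λ k′ → IsModel k′ H
  YΔ-preserves {G = G} {H} 5≤b b≤c M Y =
    let t , g-v = YΔ-centre {G = G} {H} 5≤b (≤-trans 5≤b b≤c) M Y in YΔ-at-centre b≤c M Y t g-v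

  K1bc-model : IsModel 0 (K1bcOn b c)
  K1bc-model = modelled z≤n (mk↔ₛ′ label unlabel label-unlabel unlabel-label) adj-label
    where
    label : Fin (suc (b + c)) → Vertex 0
    label fzero = apex
    label (fsuc i) = [ inB , inC ] (splitAt b i)

    unlabel : Vertex 0 → Fin (suc (b + c))
    unlabel apex    = fzero
    unlabel (inB i) = fsuc (i ↑ˡ c)
    unlabel (inC j) = fsuc (b ↑ʳ j)

    unlabel-label : ∀ w → unlabel (label w) ≡ w
    unlabel-label fzero = refl
    unlabel-label (fsuc i) with splitAt b i in e
    ... | inj₁ _ = cong fsuc (trans (cong (join b c) (sym e)) (join-splitAt b c i))
    ... | inj₂ _ = cong fsuc (trans (cong (join b c) (sym e)) (join-splitAt b c i))

    label-unlabel : ∀ a → label (unlabel a) ≡ a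
    label-unlabel apex    = refl
    label-unlabel (inB i) rewrite splitAt-↑ˡ b i c = refl
    label-unlabel (inC j) rewrite splitAt-↑ʳ b c j = refl

    side : Vertex 0 → ℕ
    side apex    = 0
    side (inB _) = 1
    side (inC _) = 2

    part-unlabel : ∀ a → part b (toℕ (unlabel a)) ≡ side a
    part-unlabel apex    = refl
    part-unlabel (inB i) rewrite toℕ-↑ˡ i c | <⇒<ᵇ-true (toℕ<n i) = refl
    part-unlabel (inC j) rewrite toℕ-↑ʳ b j | ≥⇒<ᵇ-false (b + toℕ j) b (m≤m+n b (toℕ j)) = refl

    edge-side : ∀ a d → edge a d ≡ not (side a ≡ᵇ side d)
    edge-side apex    apex    = refl
    edge-side apex    (inB _) = refl
    edge-side apex    (inC _) = refl
    edge-side (inB _) apex    = refl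
    edge-side (inB _) (inB _) = refl
    edge-side (inB _) (inC _) = cong not (∧-zeroʳ _)
    edge-side (inC _) apex    = refl
    edge-side (inC _) (inB _) = cong not (∧-zeroʳ _)
    edge-side (inC _) (inC _) = refl

    adj-label : ∀ i j → adj (K1bcOn b c) i j ≡ edge (label i) (label j)
    adj-label i j = begin
      not (part b (toℕ i) ≡ᵇ part b (toℕ j))
        ≡⟨ cong₂ (λ p q → not (part b (toℕ p) ≡ᵇ part b (toℕ q))) (unlabel-label i) (unlabel-label j) ⟨
      not (part b (toℕ (unlabel (label i))) ≡ᵇ part b (toℕ (unlabel (label j))))
        ≡⟨ cong₂ (λ p q → not (p ≡ᵇ q)) (part-unlabel (label i)) (part-unlabel (label j)) ⟩
      not (side (label i) ≡ᵇ side (label j))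
        ≡⟨ edge-side (label i) (label j) ⟨
      edge (label i) (label j) ∎
      where open ≡-Reasoning

module Family (b c : ℕ) (5≤b : 5 ≤ b) (b≤c : b ≤ c) where
  open Model b c

  model : ∀ k → k ≤ b → Σ (GraphOn (k + suc (b + c))) λ G → Cousin (K1bc b c) (_ , G) × IsModel k G
  model zero    _   = K1bcOn b c , ε , K1bc-model
  model (suc k) k<b =
    let G , G-cousin , M = model k (<⇒≤ k<b)
        H , δ = ΔY-exists M k<b (<-≤-trans k<b b≤c)
    in H , G-cousin ◅◅ (dy δ ◅ ε) , ΔY-preserves M δ

  Modelled : Graph → Set
  Modelled (_ , G) = ∃ λ k → IsModel k G

  cousin-modelled : ∀ {X Y} → Cousin X Y → Modelled X → Modelled Y
  cousin-modelled ε             M′      = M′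
  cousin-modelled (dy δ ◅ rest) (k , M) = cousin-modelled rest (suc k , ΔY-preserves M δ)
  cousin-modelled (yd Y ◅ rest) (k , M) = cousin-modelled rest (YΔ-preserves 5≤b b≤c M Y)

theorem4 : (b c : ℕ) → 6 ≤ b → b ≤ c →
    Σ (Fin (1 + b) → Graph) λ reps →
      (∀ k → Cousin (K1bc b c) (reps k))
      × (∀ k l → reps k ≅ reps l → k ≡ l)
      × (∀ H → Cousin (K1bc b c) H → ∃ λ k → H ≅ reps k)
theorem4 b c 6≤b b≤c = rep , rep-cousin , rep-distinct , cousin≅rep
  where
  open Model b c
  open Family b c (<⇒≤ 6≤b) b≤c

  modelAt : (m : Fin (1 + b)) →
           Σ (GraphOn (toℕ m + suc (b + c))) λ G → Cousin (K1bc b c) (_ , G) × IsModel (toℕ m) G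
  modelAt m = model (toℕ m) (≤-pred (toℕ<n m))

  rep : Fin (1 + b) → Graph
  rep m = _ , proj₁ (modelAt m)

  rep-cousin : ∀ m → Cousin (K1bc b c) (rep m)
  rep-cousin m = proj₁ (proj₂ (modelAt m))

  rep-distinct : ∀ m l → rep m ≅ rep l → m ≡ l
  rep-distinct m l e = toℕ-injective (+-cancelʳ-≡ (suc (b + c)) (toℕ m) (toℕ l)
                                        (≅⇒vertices≡ {G = proj₁ (modelAt m)} {proj₁ (modelAt l)} e))

  cousin≅rep : ∀ H → Cousin (K1bc b c) H → ∃ λ m → H ≅ rep m
  cousin≅rep H H-cousin with cousin-modelled H-cousin (0 , K1bc-model)
  ... | k , M = m , IsModel-≅ M (subst (λ k′ → IsModel k′ (proj₂ (rep m))) (toℕ-fromℕ< _) (proj₂ (proj₂ (modelAt m))))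
    where m = fromℕ< (s≤s (IsModel.k≤b M))
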